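{- Let $m\ge 4$ be an even integer. Then the rose window graph $R_{2m}(m-2,m-1)$ is a Cayley graph.
   Context: For integers $n\ge 3$ and $1\le a,r\le n-1$, the rose window graph $R_n(a,r)$ has vertex set $\{A_i,B_i : i\in\mathbb{Z}_n\}$ and edges $A_iA_{i+1}$, $A_iB_i$, $A_{i+a}B_i$ and $B_iB_{i+r}$, indices taken modulo $n$. A graph is Cayley iff its automorphism group has a subgroup acting regularly on its vertices. -}

module Defs where

open import Data.Nat using (ℕ; zero; suc; _+_)
open import Data.Nat.DivMod using (_mod_)
open import Data.Fin using (Fin; toℕ)
open import Data.Sum using (_⊎_)
open import Data.Product using (Σ; _×_; ∃)
open import Relation.Binary.PropositionalEquality using (_≡_)

_+ₘ_ : {n : ℕ} → Fin n → ℕ → Fin n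
_+ₘ_ {suc n} i k = (toℕ i + k) mod (suc n)

record Graph : Set₁ where
  field
    Vertex : Set
    Adj    : Vertex → Vertex → Set
open Graph public

data RoseVertex (n : ℕ) : Set where
  A : Fin n → RoseVertex n
  B : Fin n → RoseVertex n

data RoseEdge (n a r : ℕ) : RoseVertex n → RoseVertex n → Set where
  rim   : (i : Fin n) → RoseEdge n a r (A i) (A (i +ₘ 1))
  spoke : (i : Fin n) → RoseEdge n a r (A i) (B i)
  twist : (i : Fin n) → RoseEdge n a r (A (i +ₘ a)) (B i)
  hub   : (i : Fin n) → RoseEdge n a r (B i) (B (i +ₘ r))

Rose : (n a r : ℕ) → Graph
Rose n a r = record
  { Vertex = RoseVertex n
  ; Adj    = λ u v → RoseEdge n a r u v ⊎ RoseEdge n a r v u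
  }

record Automorphism (Γ : Graph) : Set where
  field
    fun      : Vertex Γ → Vertex Γ
    inv      : Vertex Γ → Vertex Γ
    inv-left  : ∀ v → inv (fun v) ≡ v
    inv-right : ∀ v → fun (inv v) ≡ v
    preserve : ∀ u v → Adj Γ u v → Adj Γ (fun u) (fun v)
    reflect  : ∀ u v → Adj Γ (fun u) (fun v) → Adj Γ u v
open Automorphism public

idAut : (Γ : Graph) → Automorphism Γ
idAut Γ = record
  { fun = λ v → v ; inv = λ v → v
  ; inv-left = λ v → Relation.Binary.PropositionalEquality.refl
  ; inv-right = λ v → Relation.Binary.PropositionalEquality.refl
  ; preserve = λ u v e → e ; reflect = λ u v e → e }

_∘A_ : {Γ : Graph} → Automorphism Γ → Automorphism Γ → Automorphism Γ
_∘A_ {Γ} σ τ = record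
  { fun = λ v → fun σ (fun τ v)
  ; inv = λ v → inv τ (inv σ v)
  ; inv-left = λ v → trans (cong (inv τ) (inv-left σ (fun τ v))) (inv-left τ v)
  ; inv-right = λ v → trans (cong (fun σ) (inv-right τ (inv σ v))) (inv-right σ v)
  ; preserve = λ u v e → preserve σ _ _ (preserve τ u v e)
  ; reflect = λ u v e → reflect τ u v (reflect σ _ _ e) }
  where open Relation.Binary.PropositionalEquality using (trans; cong)

invA : {Γ : Graph} → Automorphism Γ → Automorphism Γ
invA {Γ} σ = record
  { fun = inv σ ; inv = fun σ
  ; inv-left = inv-right σ ; inv-right = inv-left σ
  ; preserve = λ u v e → reflect σ _ _ (subst₂ (Adj Γ) (sym (inv-right σ u)) (sym (inv-right σ v)) e)
  ; reflect = λ u v e → subst₂ (Adj Γ) (inv-right σ u) (inv-right σ v) (preserve σ _ _ e) }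
  where open Relation.Binary.PropositionalEquality using (sym; subst₂)

record IsSubgroup {Γ : Graph} (H : Automorphism Γ → Set) : Set₁ where
  field
    has-id  : H (idAut Γ)
    has-∘   : ∀ σ τ → H σ → H τ → H (σ ∘A τ)
    has-inv : ∀ σ → H σ → H (invA σ)

-- H acts regularly on the vertices: transitively, and with trivial
-- stabilisers (two elements of H agreeing at one vertex are equal).
record ActsRegularly {Γ : Graph} (H : Automorphism Γ → Set) : Set₁ where
  field
    transitive : ∀ u v → Σ (Automorphism Γ) λ σ → H σ × (fun σ u ≡ v)
    free       : ∀ σ τ → H σ → H τ → ∀ u → fun σ u ≡ fun τ u →
                 ∀ w → fun σ w ≡ fun τ w

IsCayley : Graph → Set₁
IsCayley Γ = Σ (Automorphism Γ → Set) λ H → IsSubgroup H × ActsRegularly H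

-- The rotations A_i ↦ A_{i+k}, B_i ↦ B_{i+k} are automorphisms of R_n(a,r), and so is the swap
-- A_i ↦ B_{ri}, B_i ↦ A_{ri} as soon as r² ≡ 1 and (r+1)a ≡ 0 (mod n): the swap exchanges rim
-- and hub edges (the hub step r is sent to r² ≡ 1) and maps the twist edges onto themselves
-- (r(i+a) + a ≡ ri). The rotations together with the swaps followed by a rotation form a group
-- of order 2n acting regularly on the 2n vertices. For n = 2m, a = m - 2, r = m - 1 with m even,
-- r² = 1 + (m/2 - 1)·2m and (r+1)a = (m/2 - 1)·2m.
module Submission where

open import Defs
open import Data.Nat using (ℕ; _≤_; _*_; _∸_)
open import Data.Nat.Divisibility using (_∣_)

open import Data.Nat using (suc; pred; _+_; _%_; s≤s)
open import Data.Nat.Properties using (+-assoc; +-comm; +-identityʳ; *-identityˡ; *-identityʳ; *-zeroʳ; *-assoc; *-distribˡ-+; *-comm)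
open import Data.Nat.DivMod using (_mod_; m%n%n≡m%n; m%n<n; m<n⇒m%n≡m; [m+kn]%n≡m%n; %-distribˡ-+; %-distribˡ-*)
open import Data.Nat.Divisibility using (divides)
open import Data.Nat.Tactic.RingSolver using (solve-∀)
open import Data.Fin using (Fin; toℕ)
open import Data.Fin.Properties using (toℕ-injective; toℕ<n; toℕ-fromℕ<)
open import Data.Sum using (inj₁; inj₂) renaming (swap to ⊎-swap)
open import Data.Product using (Σ; _,_)
open import Function using (_∘_)
open import Relation.Binary using (Setoid; IsEquivalence)
import Relation.Binary.Reasoning.Setoid
open import Relation.Binary.PropositionalEquality

record RegularFamily (Γ : Graph) : Set₁ where
  field
    Index      : Set
    aut        : Index → Automorphism Γ
    aut-id     : Σ Index λ p → ∀ v → fun (aut p) v ≡ v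
    aut-∘      : ∀ p q → Σ Index λ pq → ∀ v → fun (aut p) (fun (aut q) v) ≡ fun (aut pq) v
    aut-inv    : ∀ p → Σ Index λ p⁻¹ → ∀ v → inv (aut p) v ≡ fun (aut p⁻¹) v
    transitive : ∀ u v → Σ Index λ p → fun (aut p) u ≡ v
    free       : ∀ p q u → fun (aut p) u ≡ fun (aut q) u →
                 ∀ w → fun (aut p) w ≡ fun (aut q) w

regularFamily⇒isCayley : {Γ : Graph} → RegularFamily Γ → IsCayley Γ
regularFamily⇒isCayley {Γ} F = H , subgroup , regular
  where
  open RegularFamily F

  H : Automorphism Γ → Set
  H σ = Σ Index λ p → ∀ v → fun σ v ≡ fun (aut p) v

  subgroup : IsSubgroup H
  subgroup = record
    { has-id  = let (p , p≗id) = aut-id in p , λ v → sym (p≗id v)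
    ; has-∘   = λ { σ τ (p , σ≗p) (q , τ≗q) → let (pq , pq≗) = aut-∘ p q in
                  pq , λ v → trans (cong (fun σ) (τ≗q v)) (trans (σ≗p _) (pq≗ v)) }
    ; has-inv = λ { σ (p , σ≗p) → let (p⁻¹ , p⁻¹≗) = aut-inv p in
                  p⁻¹ , λ v → trans (inv-of {σ} σ≗p v) (p⁻¹≗ v) } }
    where
    inv-of : ∀ {σ p} → (∀ v → fun σ v ≡ fun (aut p) v) → ∀ v → inv σ v ≡ inv (aut p) v
    inv-of {σ} {p} σ≗p v = begin
      inv σ v                                 ≡⟨ cong (inv σ) (inv-right (aut p) v) ⟨
      inv σ (fun (aut p) (inv (aut p) v))     ≡⟨ cong (inv σ) (σ≗p _) ⟨
      inv σ (fun σ (inv (aut p) v))           ≡⟨ inv-left σ _ ⟩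
      inv (aut p) v                           ∎
      where open ≡-Reasoning

  regular : ActsRegularly H
  regular = record
    { transitive = λ u v → let (p , pu≡v) = transitive u v in aut p , (p , λ _ → refl) , pu≡v
    ; free = λ { σ τ (p , σ≗p) (q , τ≗q) u σu≡τu w →
        trans (σ≗p w) (trans (free p q u (trans (sym (σ≗p u)) (trans σu≡τu (τ≗q u))) w) (sym (τ≗q w))) } }

module Modular (N : ℕ) where

  n : ℕ
  n = suc N

  infix 4 _≈_
  record _≈_ (x y : ℕ) : Set where
    constructor mod-≡
    field %-≡ : x % n ≡ y % n

  ≈-isEquivalence : IsEquivalence _≈_
  ≈-isEquivalence = record
    { refl  = mod-≡ refl
    ; sym   = λ (mod-≡ p) → mod-≡ (sym p)
    ; trans = λ (mod-≡ p) (mod-≡ q) → mod-≡ (trans p q) }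

  ≈-setoid : Setoid _ _
  ≈-setoid = record { isEquivalence = ≈-isEquivalence }

  module ≈-Reasoning = Relation.Binary.Reasoning.Setoid ≈-setoid

  open IsEquivalence ≈-isEquivalence public
    using () renaming (refl to ≈-refl; sym to ≈-sym; trans to ≈-trans)

  ≡⇒≈ : ∀ {x y} → x ≡ y → x ≈ y
  ≡⇒≈ refl = ≈-refl

  +-cong : ∀ {x x′ y y′} → x ≈ x′ → y ≈ y′ → x + y ≈ x′ + y′
  +-cong {x} {x′} {y} {y′} (mod-≡ p) (mod-≡ q) = mod-≡ (begin
    (x + y) % n                ≡⟨ %-distribˡ-+ x y n ⟩
    (x % n + y % n) % n        ≡⟨ cong₂ (λ u v → (u + v) % n) p q ⟩
    (x′ % n + y′ % n) % n      ≡⟨ %-distribˡ-+ x′ y′ n ⟨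
    (x′ + y′) % n              ∎)
    where open ≡-Reasoning

  *-cong : ∀ {x x′ y y′} → x ≈ x′ → y ≈ y′ → x * y ≈ x′ * y′
  *-cong {x} {x′} {y} {y′} (mod-≡ p) (mod-≡ q) = mod-≡ (begin
    (x * y) % n                ≡⟨ %-distribˡ-* x y n ⟩
    (x % n * (y % n)) % n      ≡⟨ cong₂ (λ u v → (u * v) % n) p q ⟩
    (x′ % n * (y′ % n)) % n    ≡⟨ %-distribˡ-* x′ y′ n ⟨
    (x′ * y′) % n              ∎)
    where open ≡-Reasoning

  +-multiple : ∀ x k → x + k * n ≈ x
  +-multiple x k = mod-≡ ([m+kn]%n≡m%n x k n)

  +-inverseʳ : ∀ k → k + N * k ≈ 0
  +-inverseʳ k = ≈-trans (≡⇒≈ (*-comm n k)) (+-multiple 0 k)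

  +-cancelˡ : ∀ x {k l} → x + k ≈ x + l → k ≈ l
  +-cancelˡ x {k} {l} x+k≈x+l = begin
    k                    ≈⟨ +-multiple k x ⟨
    k + x * n            ≡⟨ shuffle x k N ⟨
    (x + k) + N * x      ≈⟨ +-cong x+k≈x+l ≈-refl ⟩
    (x + l) + N * x      ≡⟨ shuffle x l N ⟩
    l + x * n            ≈⟨ +-multiple l x ⟩
    l                    ∎
    where
    open ≈-Reasoning
    shuffle : ∀ x k N → (x + k) + N * x ≡ k + x * suc N
    shuffle = solve-∀

  toℕ-mod : ∀ x → toℕ (x mod n) ≈ x
  toℕ-mod x = mod-≡ (trans (cong (_% n) (toℕ-fromℕ< (m%n<n x n))) (m%n%n≡m%n x n))

  toℕ-injective-≈ : {i j : Fin n} → toℕ i ≈ toℕ j → i ≡ j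
  toℕ-injective-≈ {i} {j} (mod-≡ p) = toℕ-injective
    (trans (sym (m<n⇒m%n≡m (toℕ<n i))) (trans p (m<n⇒m%n≡m (toℕ<n j))))

  toℕ-+ₘ : ∀ (i : Fin n) k → toℕ (i +ₘ k) ≈ toℕ i + k
  toℕ-+ₘ i k = toℕ-mod (toℕ i + k)

  +ₘ-assoc : ∀ (i : Fin n) k l → (i +ₘ k) +ₘ l ≡ i +ₘ (k + l)
  +ₘ-assoc i k l = toℕ-injective-≈ (begin
    toℕ ((i +ₘ k) +ₘ l)    ≈⟨ toℕ-+ₘ (i +ₘ k) l ⟩
    toℕ (i +ₘ k) + l       ≈⟨ +-cong (toℕ-+ₘ i k) ≈-refl ⟩
    toℕ i + k + l          ≡⟨ +-assoc (toℕ i) k l ⟩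
    toℕ i + (k + l)        ≈⟨ toℕ-+ₘ i (k + l) ⟨
    toℕ (i +ₘ (k + l))     ∎)
    where open ≈-Reasoning

  +ₘ-congˡ : ∀ (i : Fin n) {k l} → k ≈ l → i +ₘ k ≡ i +ₘ l
  +ₘ-congˡ i {k} {l} k≈l = toℕ-injective-≈
    (≈-trans (toℕ-+ₘ i k) (≈-trans (+-cong ≈-refl k≈l) (≈-sym (toℕ-+ₘ i l))))

  +ₘ-identityʳ : ∀ (i : Fin n) {k} → k ≈ 0 → i +ₘ k ≡ i
  +ₘ-identityʳ i {k} k≈0 = toℕ-injective-≈
    (≈-trans (toℕ-+ₘ i k) (≈-trans (+-cong ≈-refl k≈0) (≡⇒≈ (+-identityʳ (toℕ i)))))

  +ₘ-cancelˡ : ∀ (i : Fin n) {k l} → i +ₘ k ≡ i +ₘ l → k ≈ l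
  +ₘ-cancelˡ i {k} {l} eq = +-cancelˡ (toℕ i)
    (≈-trans (≈-sym (toℕ-+ₘ i k)) (≈-trans (≡⇒≈ (cong toℕ eq)) (toℕ-+ₘ i l)))

  +ₘ-right-comm : ∀ (i : Fin n) k l → (i +ₘ k) +ₘ l ≡ (i +ₘ l) +ₘ k
  +ₘ-right-comm i k l = begin
    (i +ₘ k) +ₘ l   ≡⟨ +ₘ-assoc i k l ⟩
    i +ₘ (k + l)    ≡⟨ cong (i +ₘ_) (+-comm k l) ⟩
    i +ₘ (l + k)    ≡⟨ +ₘ-assoc i l k ⟨
    (i +ₘ l) +ₘ k   ∎
    where open ≡-Reasoning

  +ₘ-surjective : ∀ (i j : Fin n) → Σ ℕ λ k → i +ₘ k ≡ j
  +ₘ-surjective i j = toℕ j + N * toℕ i , toℕ-injective-≈ (begin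
    toℕ (i +ₘ (toℕ j + N * toℕ i))    ≈⟨ toℕ-+ₘ i _ ⟩
    toℕ i + (toℕ j + N * toℕ i)       ≡⟨ shuffle (toℕ i) (toℕ j) N ⟩
    toℕ j + toℕ i * n                 ≈⟨ +-multiple (toℕ j) (toℕ i) ⟩
    toℕ j                             ∎)
    where
    open ≈-Reasoning
    shuffle : ∀ x y N → x + (y + N * x) ≡ y + x * suc N
    shuffle = solve-∀

  infix 25 _·ₘ_
  _·ₘ_ : ℕ → Fin n → Fin n
  c ·ₘ i = (c * toℕ i) mod n

  ·ₘ-distrib-+ₘ : ∀ c (i : Fin n) l → c ·ₘ (i +ₘ l) ≡ (c ·ₘ i) +ₘ (c * l)
  ·ₘ-distrib-+ₘ c i l = toℕ-injective-≈ (begin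
    toℕ (c ·ₘ (i +ₘ l))        ≈⟨ toℕ-mod _ ⟩
    c * toℕ (i +ₘ l)           ≈⟨ *-cong (≈-refl {c}) (toℕ-+ₘ i l) ⟩
    c * (toℕ i + l)            ≡⟨ *-distribˡ-+ c (toℕ i) l ⟩
    c * toℕ i + c * l          ≈⟨ +-cong (toℕ-mod (c * toℕ i)) (≈-refl {c * l}) ⟨
    toℕ (c ·ₘ i) + c * l       ≈⟨ toℕ-+ₘ (c ·ₘ i) (c * l) ⟨
    toℕ ((c ·ₘ i) +ₘ (c * l))  ∎)
    where open ≈-Reasoning

  ·ₘ-involutive : ∀ c → c * c ≈ 1 → ∀ (i : Fin n) → c ·ₘ (c ·ₘ i) ≡ i
  ·ₘ-involutive c c²≈1 i = toℕ-injective-≈ (begin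
    toℕ (c ·ₘ (c ·ₘ i))        ≈⟨ toℕ-mod _ ⟩
    c * toℕ (c ·ₘ i)           ≈⟨ *-cong (≈-refl {c}) (toℕ-mod (c * toℕ i)) ⟩
    c * (c * toℕ i)            ≡⟨ *-assoc c c (toℕ i) ⟨
    c * c * toℕ i              ≈⟨ *-cong c²≈1 ≈-refl ⟩
    1 * toℕ i                  ≡⟨ *-identityˡ (toℕ i) ⟩
    toℕ i                      ∎)
    where open ≈-Reasoning

module RoseWindow (N a r : ℕ) where
  open Modular N

  Edge : RoseVertex n → RoseVertex n → Set
  Edge = RoseEdge n a r

  Adjacent : RoseVertex n → RoseVertex n → Set
  Adjacent = Adj (Rose n a r)

  index : RoseVertex n → Fin n
  index (A i) = i
  index (B i) = i

  rotate : ℕ → RoseVertex n → RoseVertex n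
  rotate k (A i) = A (i +ₘ k)
  rotate k (B i) = B (i +ₘ k)

  rotate-rotate : ∀ k l v → rotate k (rotate l v) ≡ rotate (l + k) v
  rotate-rotate k l (A i) = cong A (+ₘ-assoc i l k)
  rotate-rotate k l (B i) = cong B (+ₘ-assoc i l k)

  rotate-cong : ∀ {k l} → k ≈ l → ∀ v → rotate k v ≡ rotate l v
  rotate-cong k≈l (A i) = cong A (+ₘ-congˡ i k≈l)
  rotate-cong k≈l (B i) = cong B (+ₘ-congˡ i k≈l)

  rotate-identity : ∀ {k} → k ≈ 0 → ∀ v → rotate k v ≡ v
  rotate-identity k≈0 (A i) = cong A (+ₘ-identityʳ i k≈0)
  rotate-identity k≈0 (B i) = cong B (+ₘ-identityʳ i k≈0)

  rotate-cancel : ∀ {k l} v → rotate k v ≡ rotate l v → k ≈ l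
  rotate-cancel (A i) eq = +ₘ-cancelˡ i (cong index eq)
  rotate-cancel (B i) eq = +ₘ-cancelˡ i (cong index eq)

  rotate-edge : ∀ k {u v} → Edge u v → Edge (rotate k u) (rotate k v)
  rotate-edge k (rim i)   = subst (λ j → Edge (A (i +ₘ k)) (A j)) (+ₘ-right-comm i k 1) (rim (i +ₘ k))
  rotate-edge k (spoke i) = spoke (i +ₘ k)
  rotate-edge k (twist i) = subst (λ j → Edge (A j) (B (i +ₘ k))) (+ₘ-right-comm i k a) (twist (i +ₘ k))
  rotate-edge k (hub i)   = subst (λ j → Edge (B (i +ₘ k)) (B j)) (+ₘ-right-comm i k r) (hub (i +ₘ k))

  edge-preserving⇒adjacency-preserving : (f : RoseVertex n → RoseVertex n) →
    (∀ {u v} → Edge u v → Adjacent (f u) (f v)) →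
    ∀ {u v} → Adjacent u v → Adjacent (f u) (f v)
  edge-preserving⇒adjacency-preserving f f-edge (inj₁ e) = f-edge e
  edge-preserving⇒adjacency-preserving f f-edge (inj₂ e) = ⊎-swap (f-edge e)

  swap : RoseVertex n → RoseVertex n
  swap (A i) = B (r ·ₘ i)
  swap (B i) = A (r ·ₘ i)

  swap-rotate : ∀ l v → swap (rotate l v) ≡ rotate (r * l) (swap v)
  swap-rotate l (A i) = cong B (·ₘ-distrib-+ₘ r i l)
  swap-rotate l (B i) = cong A (·ₘ-distrib-+ₘ r i l)

  module _ (r²≈1 : r * r ≈ 1) (ra+a≈0 : r * a + a ≈ 0) where

    swap-involutive : ∀ v → swap (swap v) ≡ v
    swap-involutive (A i) = cong A (·ₘ-involutive r r²≈1 i)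
    swap-involutive (B i) = cong B (·ₘ-involutive r r²≈1 i)

    swap-edge : ∀ {u v} → Edge u v → Adjacent (swap u) (swap v)
    swap-edge (rim i)   = inj₁ (subst (λ j → Edge (B (r ·ₘ i)) (B j)) rim-image (hub (r ·ₘ i)))
      where
      rim-image : (r ·ₘ i) +ₘ r ≡ r ·ₘ (i +ₘ 1)
      rim-image = begin
        (r ·ₘ i) +ₘ r          ≡⟨ +ₘ-congˡ (r ·ₘ i) (≡⇒≈ (sym (*-identityʳ r))) ⟩
        (r ·ₘ i) +ₘ (r * 1)    ≡⟨ ·ₘ-distrib-+ₘ r i 1 ⟨
        r ·ₘ (i +ₘ 1)          ∎
        where open ≡-Reasoning
    swap-edge (spoke i) = inj₂ (spoke (r ·ₘ i))
    swap-edge (twist i) = inj₂ (subst (λ j → Edge (A j) (B (r ·ₘ (i +ₘ a)))) twist-image (twist (r ·ₘ (i +ₘ a))))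
      where
      twist-image : (r ·ₘ (i +ₘ a)) +ₘ a ≡ r ·ₘ i
      twist-image = begin
        (r ·ₘ (i +ₘ a)) +ₘ a          ≡⟨ cong (_+ₘ a) (·ₘ-distrib-+ₘ r i a) ⟩
        ((r ·ₘ i) +ₘ (r * a)) +ₘ a    ≡⟨ +ₘ-assoc (r ·ₘ i) (r * a) a ⟩
        (r ·ₘ i) +ₘ (r * a + a)       ≡⟨ +ₘ-identityʳ (r ·ₘ i) ra+a≈0 ⟩
        r ·ₘ i                        ∎
        where open ≡-Reasoning
    swap-edge (hub i)   = inj₁ (subst (λ j → Edge (A (r ·ₘ i)) (A j)) hub-image (rim (r ·ₘ i)))
      where
      hub-image : (r ·ₘ i) +ₘ 1 ≡ r ·ₘ (i +ₘ r)
      hub-image = begin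
        (r ·ₘ i) +ₘ 1          ≡⟨ +ₘ-congˡ (r ·ₘ i) (≈-sym r²≈1) ⟩
        (r ·ₘ i) +ₘ (r * r)    ≡⟨ ·ₘ-distrib-+ₘ r i r ⟨
        r ·ₘ (i +ₘ r)          ∎
        where open ≡-Reasoning

    data Motion : Set where
      rot rot-swap : ℕ → Motion

    motion : Motion → RoseVertex n → RoseVertex n
    motion (rot k)      = rotate k
    motion (rot-swap k) = rotate k ∘ swap

    infixl 7 _∙_
    _∙_ : Motion → Motion → Motion
    rot k      ∙ rot l      = rot (l + k)
    rot k      ∙ rot-swap l = rot-swap (l + k)
    rot-swap k ∙ rot l      = rot-swap (r * l + k)
    rot-swap k ∙ rot-swap l = rot (r * l + k)

    motion-∙ : ∀ p q v → motion p (motion q v) ≡ motion (p ∙ q) v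
    motion-∙ (rot k)      (rot l)      v = rotate-rotate k l v
    motion-∙ (rot k)      (rot-swap l) v = rotate-rotate k l (swap v)
    motion-∙ (rot-swap k) (rot l)      v = begin
      rotate k (swap (rotate l v))          ≡⟨ cong (rotate k) (swap-rotate l v) ⟩
      rotate k (rotate (r * l) (swap v))    ≡⟨ rotate-rotate k (r * l) (swap v) ⟩
      rotate (r * l + k) (swap v)           ∎
      where open ≡-Reasoning
    motion-∙ (rot-swap k) (rot-swap l) v = begin
      rotate k (swap (rotate l (swap v)))          ≡⟨ cong (rotate k) (swap-rotate l (swap v)) ⟩
      rotate k (rotate (r * l) (swap (swap v)))    ≡⟨ cong (rotate k ∘ rotate (r * l)) (swap-involutive v) ⟩
      rotate k (rotate (r * l) v)                  ≡⟨ rotate-rotate k (r * l) v ⟩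
      rotate (r * l + k) v                         ∎
      where open ≡-Reasoning

    infix 8 _⁻¹
    _⁻¹ : Motion → Motion
    rot k ⁻¹      = rot (N * k)
    rot-swap k ⁻¹ = rot-swap (r * (N * k))

    ⁻¹-∙-identity : ∀ p v → motion (p ⁻¹ ∙ p) v ≡ v
    ⁻¹-∙-identity (rot k)      = rotate-identity (+-inverseʳ k)
    ⁻¹-∙-identity (rot-swap k) = rotate-identity (begin
      r * k + r * (N * k)    ≡⟨ *-distribˡ-+ r k (N * k) ⟨
      r * (k + N * k)        ≈⟨ *-cong (≈-refl {r}) (+-inverseʳ k) ⟩
      r * 0                  ≡⟨ *-zeroʳ r ⟩
      0                      ∎)
      where open ≈-Reasoning

    ∙-⁻¹-identity : ∀ p v → motion (p ∙ p ⁻¹) v ≡ v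
    ∙-⁻¹-identity (rot k)      = rotate-identity (≈-trans (≡⇒≈ (+-comm (N * k) k)) (+-inverseʳ k))
    ∙-⁻¹-identity (rot-swap k) = rotate-identity (begin
      r * (r * (N * k)) + k    ≈⟨ +-cong (≡⇒≈ (*-assoc r r (N * k))) (≈-refl {k}) ⟨
      r * r * (N * k) + k      ≈⟨ +-cong (*-cong r²≈1 (≈-refl {N * k})) (≈-refl {k}) ⟩
      1 * (N * k) + k          ≡⟨ cong (_+ k) (*-identityˡ (N * k)) ⟩
      N * k + k                ≡⟨ +-comm (N * k) k ⟩
      k + N * k                ≈⟨ +-inverseʳ k ⟩
      0                        ∎)
      where open ≈-Reasoning

    motion-inverseˡ : ∀ p v → motion (p ⁻¹) (motion p v) ≡ v
    motion-inverseˡ p v = trans (motion-∙ (p ⁻¹) p v) (⁻¹-∙-identity p v)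

    motion-inverseʳ : ∀ p v → motion p (motion (p ⁻¹) v) ≡ v
    motion-inverseʳ p v = trans (motion-∙ p (p ⁻¹) v) (∙-⁻¹-identity p v)

    motion-adjacent : ∀ p {u v} → Adjacent u v → Adjacent (motion p u) (motion p v)
    motion-adjacent (rot k) = edge-preserving⇒adjacency-preserving (rotate k) (inj₁ ∘ rotate-edge k)
    motion-adjacent (rot-swap k) =
      edge-preserving⇒adjacency-preserving (rotate k) (inj₁ ∘ rotate-edge k) ∘
      edge-preserving⇒adjacency-preserving swap swap-edge

    motionAut : Motion → Automorphism (Rose n a r)
    motionAut p = record
      { fun       = motion p
      ; inv       = motion (p ⁻¹)
      ; inv-left  = motion-inverseˡ p
      ; inv-right = motion-inverseʳ p
      ; preserve  = λ _ _ → motion-adjacent p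
      ; reflect   = λ u v e → subst₂ Adjacent (motion-inverseˡ p u) (motion-inverseˡ p v)
                                (motion-adjacent (p ⁻¹) e) }

    motion-transitive : ∀ u v → Σ Motion λ p → motion p u ≡ v
    motion-transitive (A i) (A j) = let (k , eq) = +ₘ-surjective i j in rot k , cong A eq
    motion-transitive (B i) (B j) = let (k , eq) = +ₘ-surjective i j in rot k , cong B eq
    motion-transitive (A i) (B j) = let (k , eq) = +ₘ-surjective (r ·ₘ i) j in rot-swap k , cong B eq
    motion-transitive (B i) (A j) = let (k , eq) = +ₘ-surjective (r ·ₘ i) j in rot-swap k , cong A eq

    motion-free : ∀ p q u → motion p u ≡ motion q u → ∀ w → motion p w ≡ motion q w
    motion-free (rot k)      (rot l)      u eq w = rotate-cong (rotate-cancel u eq) w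
    motion-free (rot-swap k) (rot-swap l) u eq w = rotate-cong (rotate-cancel (swap u) eq) (swap w)
    motion-free (rot k)      (rot-swap l) (A i) ()
    motion-free (rot k)      (rot-swap l) (B i) ()
    motion-free (rot-swap k) (rot l)      (A i) ()
    motion-free (rot-swap k) (rot l)      (B i) ()

    motionFamily : RegularFamily (Rose n a r)
    motionFamily = record
      { Index      = Motion
      ; aut        = motionAut
      ; aut-id     = rot 0 , rotate-identity ≈-refl
      ; aut-∘      = λ p q → p ∙ q , motion-∙ p q
      ; aut-inv    = λ p → p ⁻¹ , λ _ → refl
      ; transitive = motion-transitive
      ; free       = motion-free }

roseWindow-isCayley : ∀ N a r → let open Modular N in
  r * r ≈ 1 → r * a + a ≈ 0 → IsCayley (Rose (suc N) a r)
roseWindow-isCayley N a r r²≈1 ra+a≈0 =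
  regularFamily⇒isCayley (RoseWindow.motionFamily N a r r²≈1 ra+a≈0)

evenRoseWindow-isCayley : ∀ u → let m = suc (suc u) * 2 in
  IsCayley (Rose (2 * m) (m ∸ 2) (m ∸ 1))
evenRoseWindow-isCayley u = roseWindow-isCayley _ _ _
  (≈-trans (≡⇒≈ (square u)) (+-multiple 1 (suc u)))
  (≈-trans (≡⇒≈ (product u)) (+-multiple 0 (suc u)))
  where
  open Modular (pred (2 * (suc (suc u) * 2)))
  square : ∀ u → (3 + u * 2) * (3 + u * 2) ≡ 1 + (1 + u) * (2 * ((2 + u) * 2))
  square = solve-∀
  product : ∀ u → (3 + u * 2) * (2 + u * 2) + (2 + u * 2) ≡ 0 + (1 + u) * (2 * ((2 + u) * 2))
  product = solve-∀

mainTheorem8 : (m : ℕ) → 4 ≤ m → 2 ∣ m →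
               IsCayley (Rose (2 * m) (m ∸ 2) (m ∸ 1))
mainTheorem8 _ ()                (divides 0 refl)
mainTheorem8 _ (s≤s (s≤s ()))    (divides 1 refl)
mainTheorem8 _ _                 (divides (suc (suc u)) refl) = evenRoseWindow-isCayley u
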